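{- Let $P$ be a GPEA. Then: (i) A congruence $\sim$ on $P$ satisfying (C4), (C5$'$) is a Riesz congruence iff every equivalence class is both downward and upward directed. (ii) If $\sim$ is a Riesz congruence on $P$, then $I:=\{i\in P:i\sim 0\}$ is a normal Riesz ideal in $P$. Moreover, $\sim=\sim_I$.
   Context: $P$ is a GPEA (partial operation $\oplus$, constant $0$; partial associativity; if $a\oplus b$ exists there are $c,d$ with $a\oplus b=c\oplus a=b\oplus d$; two-sided cancellation; $0$ neutral; $a\oplus b=0\Rightarrow a=b=0$). Order: $a\le b$ iff $a\oplus c=b$ for some $c$; for $a\le b$, $a/b$ is the unique $c$ with $a\oplus c=b$, and $b\backslash a$ the unique $d$ with $d\oplus a=b$. An ideal is a nonempty down-set closed under existing sums; it is normal iff $a\oplus c=c\oplus b$ implies ($a\in I\Leftrightarrow b\in I$). (R1): if $i\in I$, $a\oplus b$ exists and $i\le a\oplus b$, there are $j,k\in I$ with $j\le a$, $k\le b$, $i\le j\oplus k$. A Riesz ideal is an R1-ideal also satisfying (R2): if $i\in I$, $i\le a$, then (i) if $(a\backslash i)\oplus b$ exists there is $j\in I$, $j\le b$, with $a\oplus(j/b)$ existing, and (ii) if $b\oplus(i/a)$ exists there is $k\in I$, $k\le b$, with $(b\backslash k)\oplus a$ existing. For an ideal $I$, $a\sim_I b$ iff there are $i,j\in I$, $i\le a$, $j\le b$, with $a\backslash i=b\backslash j$. A binary relation $\sim$ is a congruence iff: (C1) equivalence; (C2) $a\oplus b$, $a_1\oplus b_1$ exist, $a\sim a_1$, $b\sim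 b_1$ imply $a\oplus b\sim a_1\oplus b_1$; (C3) if $a\oplus b$ exists, for any $a_1\sim a$ there is $b_1\sim b$ with $a_1\oplus b_1$ existing, and for any $b_2\sim b$ there is $a_2\sim a$ with $a_2\oplus b_2$ existing. (C4): if $a\sim b$ and either $a\oplus a_1\sim b\oplus b_1$ or $a_1\oplus a\sim b_1\oplus b$, then $a_1\sim b_1$. (C5$'$): $a\sim b\oplus c$ implies $a=a_1\oplus a_2$ for some $a_1\sim b$, $a_2\sim c$. A Riesz congruence is a congruence satisfying (C4), (C5$'$) and (CR): if $a\sim b$, there are $c,d$ with $c\le a\le d$, $c\le b\le d$, $a\backslash c\sim b\backslash c\sim0$ and $d\backslash a\sim d\backslash b\sim0$. A subset is upward (downward) directed if any two elements have a common upper (lower) bound in it. -}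

module Defs where

open import Level using (Level; _⊔_; suc)
open import Data.Maybe using (Maybe; just)
open import Data.Product using (Σ; ∃; ∃-syntax; _×_; _,_)
open import Relation.Binary.PropositionalEquality using (_≡_)
open import Relation.Binary.Structures using (IsEquivalence)
open import Function.Bundles using (_⇔_)

-- A generalized pseudo-effect algebra (GPEA).
-- The partial operation ⊕ is a total function into Maybe:
-- "a ⊕ b exists and equals c" is  a ⊕ b ≡ just c.
record GPEA (c : Level) : Set (suc c) where
  field
    Carrier : Set c
    _⊕_     : Carrier → Carrier → Maybe Carrier
    𝟎       : Carrier
    assocˡ  : ∀ {a b x d e} → a ⊕ b ≡ just d → d ⊕ x ≡ just e →
              Σ Carrier λ f → (b ⊕ x ≡ just f) × (a ⊕ f ≡ just e)
    assocʳ  : ∀ {a b x f e} → b ⊕ x ≡ just f → a ⊕ f ≡ just e →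
              Σ Carrier λ d → (a ⊕ b ≡ just d) × (d ⊕ x ≡ just e)
    comm-ish : ∀ {a b s} → a ⊕ b ≡ just s →
               (Σ Carrier λ x → x ⊕ a ≡ just s) × (Σ Carrier λ y → b ⊕ y ≡ just s)
    cancelˡ : ∀ {a b x s} → a ⊕ b ≡ just s → a ⊕ x ≡ just s → b ≡ x
    cancelʳ : ∀ {a b x s} → b ⊕ a ≡ just s → x ⊕ a ≡ just s → b ≡ x
    identityʳ : ∀ a → a ⊕ 𝟎 ≡ just a
    identityˡ : ∀ a → 𝟎 ⊕ a ≡ just a
    zero-sum : ∀ {a b} → a ⊕ b ≡ just 𝟎 → (a ≡ 𝟎) × (b ≡ 𝟎)

module GPEATheory {c : Level} (P : GPEA c) where
  open GPEA P public

  Defined : Carrier → Carrier → Set c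
  Defined a b = ∃[ s ] (a ⊕ b ≡ just s)

  -- a ≤ b iff a ⊕ x = b for some x.  (Such x is unique, it is a/b;
  -- the unique y with y ⊕ a = b is b\a.  Below, a/b and b\a are referred to
  -- through witnesses x with a ⊕ x ≡ just b, resp. y ⊕ a ≡ just b.)
  _≤_ : Carrier → Carrier → Set c
  a ≤ b = ∃[ x ] (a ⊕ x ≡ just b)

  module _ {ℓ : Level} (I : Carrier → Set ℓ) where

    IsIdeal : Set (c ⊔ ℓ)
    IsIdeal = (∃[ i ] I i)
            × (∀ {a b} → I b → a ≤ b → I a)
            × (∀ {a b s} → I a → I b → a ⊕ b ≡ just s → I s)

    IsNormal : Set (c ⊔ ℓ)
    IsNormal = ∀ {a b x s} → a ⊕ x ≡ just s → x ⊕ b ≡ just s → (I a ⇔ I b)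

    R1 : Set (c ⊔ ℓ)
    R1 = ∀ {i a b s} → I i → a ⊕ b ≡ just s → i ≤ s →
         Σ Carrier λ j → Σ Carrier λ k → I j × I k × j ≤ a × k ≤ b ×
         Σ Carrier λ t → (j ⊕ k ≡ just t) × i ≤ t

    -- (R2)(i): i ∈ I, i ≤ a, (a\i) ⊕ b exists  ⇒  ∃ j ∈ I, j ≤ b, a ⊕ (j/b) exists
    -- (here d = a\i, e = j/b)
    R2i : Set (c ⊔ ℓ)
    R2i = ∀ {i a b d} → I i → d ⊕ i ≡ just a → Defined d b →
          Σ Carrier λ j → I j × Σ Carrier λ e → (j ⊕ e ≡ just b) × Defined a e

    -- (R2)(ii): i ∈ I, i ≤ a, b ⊕ (i/a) exists  ⇒  ∃ k ∈ I, k ≤ b, (b\k) ⊕ a exists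
    -- (here e = i/a, d = b\k)
    R2ii : Set (c ⊔ ℓ)
    R2ii = ∀ {i a b e} → I i → i ⊕ e ≡ just a → Defined b e →
           Σ Carrier λ k → I k × Σ Carrier λ d → (d ⊕ k ≡ just b) × Defined d a

    IsRieszIdeal : Set (c ⊔ ℓ)
    IsRieszIdeal = IsIdeal × R1 × R2i × R2ii

    -- a ∼_I b iff ∃ i, j ∈ I, i ≤ a, j ≤ b, a\i = b\j
    _∼I_ : Carrier → Carrier → Set (c ⊔ ℓ)
    a ∼I b = Σ Carrier λ i → Σ Carrier λ j → I i × I j ×
             Σ Carrier λ d → (d ⊕ i ≡ just a) × (d ⊕ j ≡ just b)

  module _ {r : Level} (_∼_ : Carrier → Carrier → Set r) where

    C1 : Set (c ⊔ r)
    C1 = IsEquivalence _∼_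

    C2 : Set (c ⊔ r)
    C2 = ∀ {a b a₁ b₁ s s₁} → a ⊕ b ≡ just s → a₁ ⊕ b₁ ≡ just s₁ →
         a ∼ a₁ → b ∼ b₁ → s ∼ s₁

    C3 : Set (c ⊔ r)
    C3 = ∀ {a b} → Defined a b →
         (∀ {a₁} → a₁ ∼ a → Σ Carrier λ b₁ → b₁ ∼ b × Defined a₁ b₁)
       × (∀ {b₂} → b₂ ∼ b → Σ Carrier λ a₂ → a₂ ∼ a × Defined a₂ b₂)

    IsCongruence : Set (c ⊔ r)
    IsCongruence = C1 × C2 × C3

    C4 : Set (c ⊔ r)
    C4 = (∀ {a b a₁ b₁ s t} → a ∼ b → a ⊕ a₁ ≡ just s → b ⊕ b₁ ≡ just t → s ∼ t → a₁ ∼ b₁)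
       × (∀ {a b a₁ b₁ s t} → a ∼ b → a₁ ⊕ a ≡ just s → b₁ ⊕ b ≡ just t → s ∼ t → a₁ ∼ b₁)

    C5′ : Set (c ⊔ r)
    C5′ = ∀ {a b x s} → a ∼ s → b ⊕ x ≡ just s →
          Σ Carrier λ a₁ → Σ Carrier λ a₂ → (a₁ ⊕ a₂ ≡ just a) × a₁ ∼ b × a₂ ∼ x

    -- (CR): a ∼ b ⇒ ∃ c ≤ a, b ≤ d with a\c ∼ b\c ∼ 0 and d\a ∼ d\b ∼ 0
    -- (x = a\c, y = b\c, u = d\a, v = d\b)
    CR : Set (c ⊔ r)
    CR = ∀ {a b} → a ∼ b →
         Σ Carrier λ cc → Σ Carrier λ d →
           (Σ Carrier λ x → (x ⊕ cc ≡ just a) × x ∼ 𝟎)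
         × (Σ Carrier λ y → (y ⊕ cc ≡ just b) × y ∼ 𝟎)
         × (Σ Carrier λ u → (u ⊕ a ≡ just d) × u ∼ 𝟎)
         × (Σ Carrier λ v → (v ⊕ b ≡ just d) × v ∼ 𝟎)

    IsRieszCongruence : Set (c ⊔ r)
    IsRieszCongruence = IsCongruence × C4 × C5′ × CR

    UpDirectedClass : Carrier → Set (c ⊔ r)
    UpDirectedClass a = ∀ {x y} → x ∼ a → y ∼ a →
                        Σ Carrier λ z → z ∼ a × x ≤ z × y ≤ z

    DownDirectedClass : Carrier → Set (c ⊔ r)
    DownDirectedClass a = ∀ {x y} → x ∼ a → y ∼ a →
                          Σ Carrier λ z → z ∼ a × z ≤ x × z ≤ y

    AllClassesDirected : Set (c ⊔ r)
    AllClassesDirected = ∀ a → DownDirectedClass a × UpDirectedClass a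

    Kernel : Carrier → Set r
    Kernel i = i ∼ 𝟎

module Submission where

-- In a congruence, adding an
-- element of the kernel I = { i ∣ i ∼ 0 } to either side of an element does
-- not change its class (absorbˡ/absorbʳ); with (C4), conversely, a summand
-- whose sum stays in the class of the other summand lies in the kernel
-- (kernelˡ/kernelʳ).  Together with some associativity bookkeeping this gives:
--   (i)  (CR) ⇒ classes are directed: the witnesses c and d of (CR) are the
--        lower and upper bounds; directed ⇒ (CR): a common lower (upper) bound
--        in the class differs from the two elements by kernel elements.
--   (ii) the kernel is a normal ideal (C4, C5′); (CR) writes any a ∼ b as
--        a = y ⊕ j, b = y ⊕ n with j, n ∈ I, which is one half of ∼ = ∼_I (the
--        other is absorption) and the core of (R1) and (R2).

open import Defs
open import Level using (Level)
open import Data.Maybe using (just)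
open import Data.Product using (Σ; _×_; _,_; proj₁; proj₂)
open import Function.Bundles using (_⇔_; mk⇔)
open import Relation.Binary.PropositionalEquality using (_≡_; refl; subst)
open import Relation.Binary.Structures using (IsEquivalence)

module _ {c : Level} (P : GPEA c) where
  open GPEATheory P

  ≤-trans : ∀ {a b d} → a ≤ b → b ≤ d → a ≤ d
  ≤-trans (x , a⊕x) (y , b⊕y) with assocˡ a⊕x b⊕y
  ... | z , _ , a⊕z = z , a⊕z

  right-summand⇒≤ : ∀ {x a s} → x ⊕ a ≡ just s → a ≤ s
  right-summand⇒≤ x⊕a = proj₂ (comm-ish x⊕a)

  ≤⇒right-summand : ∀ {a s} → a ≤ s → Σ Carrier λ x → x ⊕ a ≡ just s
  ≤⇒right-summand (_ , a⊕y) = proj₁ (comm-ish a⊕y)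

  defined-≤ʳ : ∀ {a b e} → Defined a b → e ≤ b → Defined a e
  defined-≤ʳ (_ , a⊕b) (_ , e⊕q) with assocʳ e⊕q a⊕b
  ... | t , a⊕e , _ = t , a⊕e

  defined-summandˡ : ∀ {a b x e} → Defined b a → x ⊕ e ≡ just b → Defined e a
  defined-summandˡ (_ , b⊕a) x⊕e with assocˡ x⊕e b⊕a
  ... | t , e⊕a , _ = t , e⊕a

  interchange : ∀ {y j k z a b s} → y ⊕ j ≡ just a → k ⊕ z ≡ just b → a ⊕ b ≡ just s →
                Σ Carrier λ t → Σ Carrier λ g →
                  (j ⊕ k ≡ just t) × (t ⊕ z ≡ just g) × (y ⊕ g ≡ just s)
  interchange y⊕j k⊕z a⊕b with assocˡ y⊕j a⊕b
  ... | g , j⊕b , y⊕g with assocʳ k⊕z j⊕b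
  ... | t , j⊕k , t⊕z = t , g , j⊕k , t⊕z , y⊕g

  cancel-outer : ∀ {y z t t' g g' s} →
                 t ⊕ z ≡ just g → y ⊕ g ≡ just s → t' ⊕ z ≡ just g' → y ⊕ g' ≡ just s → t ≡ t'
  cancel-outer t⊕z y⊕g t'⊕z y⊕g' with cancelˡ y⊕g y⊕g'
  ... | refl = cancelʳ t⊕z t'⊕z

  module _ {r : Level} {_∼_ : Carrier → Carrier → Set r} (cong : IsCongruence _∼_) where
    open IsEquivalence (proj₁ cong) renaming (refl to ∼-refl; sym to ∼-sym; trans to ∼-trans)

    private
      compatible : C2 _∼_
      compatible = proj₁ (proj₂ cong)

      extendable : C3 _∼_
      extendable = proj₂ (proj₂ cong)

    absorbˡ : ∀ {i d a} → i ⊕ d ≡ just a → i ∼ 𝟎 → a ∼ d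
    absorbˡ i⊕d i∼0 = compatible i⊕d (identityˡ _) i∼0 ∼-refl

    absorbʳ : ∀ {i d a} → d ⊕ i ≡ just a → i ∼ 𝟎 → a ∼ d
    absorbʳ d⊕i i∼0 = compatible d⊕i (identityʳ _) ∼-refl i∼0

    -- (CR) makes every class directed: its c and d are the common bounds.
    CR⇒directed : CR _∼_ → AllClassesDirected _∼_
    CR⇒directed cr a = down , up
      where
      down : DownDirectedClass _∼_ a
      down x∼a y∼a with cr (∼-trans x∼a (∼-sym y∼a))
      ... | e , _ , (x' , x'⊕e , x'∼0) , (_ , y'⊕e , _) , _ =
        e , ∼-trans (∼-sym (absorbˡ x'⊕e x'∼0)) x∼a ,
        right-summand⇒≤ x'⊕e , right-summand⇒≤ y'⊕e

      up : UpDirectedClass _∼_ a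
      up x∼a y∼a with cr (∼-trans x∼a (∼-sym y∼a))
      ... | _ , d , _ , _ , (u , u⊕x , u∼0) , (_ , v⊕y , _) =
        d , ∼-trans (absorbˡ u⊕x u∼0) x∼a ,
        right-summand⇒≤ u⊕x , right-summand⇒≤ v⊕y

    ∼I⇒∼ : ∀ {a b} → _∼I_ (Kernel _∼_) a b → a ∼ b
    ∼I⇒∼ (_ , _ , i∼0 , j∼0 , _ , d⊕i , d⊕j) =
      ∼-trans (absorbʳ d⊕i i∼0) (∼-sym (absorbʳ d⊕j j∼0))

    -- With (C5′) the kernel is an ideal: a ≤ b ∼ 0 splits 0 as a₁ ⊕ a₂ with a₁ ∼ a.
    kernel-ideal : C5′ _∼_ → IsIdeal (Kernel _∼_)
    kernel-ideal split = (𝟎 , ∼-refl) , downward , closed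
      where
      downward : ∀ {a b} → b ∼ 𝟎 → a ≤ b → a ∼ 𝟎
      downward b∼0 (_ , a⊕x) with split (∼-sym b∼0) a⊕x
      ... | _ , _ , a₁⊕a₂ , a₁∼a , _ = subst (_ ∼_) (proj₁ (zero-sum a₁⊕a₂)) (∼-sym a₁∼a)

      closed : ∀ {a b s} → a ∼ 𝟎 → b ∼ 𝟎 → a ⊕ b ≡ just s → s ∼ 𝟎
      closed a∼0 b∼0 a⊕b = compatible a⊕b (identityˡ 𝟎) a∼0 b∼0

    kernel-summand-to-middle : C5′ _∼_ → ∀ {i e a b s} → i ∼ 𝟎 → i ⊕ e ≡ just s → a ⊕ b ≡ just s →
      Σ Carrier λ ê → Σ Carrier λ e₂ → Σ Carrier λ f →
        (ê ⊕ i ≡ just f) × (f ⊕ e₂ ≡ just s) × ê ∼ a × e₂ ∼ b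
    kernel-summand-to-middle split i∼0 i⊕e a⊕b with split (∼-sym (absorbˡ i⊕e i∼0)) a⊕b
    ... | e₁ , e₂ , e₁⊕e₂ , e₁∼a , e₂∼b with assocʳ e₁⊕e₂ i⊕e
    ... | f , i⊕e₁ , f⊕e₂ with proj₁ (comm-ish i⊕e₁)
    ... | ê , ê⊕i =
      ê , e₂ , f , ê⊕i , f⊕e₂ ,
      ∼-trans (∼-sym (absorbʳ ê⊕i i∼0)) (∼-trans (absorbˡ i⊕e₁ i∼0) e₁∼a) , e₂∼b

    -- (R2)(i) for the kernel: (CR) bounds the element of the class of b given by (C3).
    kernel-R2i : CR _∼_ → R2i (Kernel _∼_)
    kernel-R2i cr i∼0 d⊕i d⊕b with proj₁ (extendable d⊕b) (absorbʳ d⊕i i∼0)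
    ... | b₁ , b₁∼b , a⊕b₁ with cr (∼-sym b₁∼b)
    ... | e , _ , (x , x⊕e , x∼0) , (_ , x'⊕e , _) , _ =
      x , x∼0 , e , x⊕e , defined-≤ʳ a⊕b₁ (right-summand⇒≤ x'⊕e)

    module _ (c4 : C4 _∼_) where

      kernelʳ : ∀ {a x s} → a ⊕ x ≡ just s → s ∼ a → x ∼ 𝟎
      kernelʳ a⊕x s∼a = proj₁ c4 ∼-refl a⊕x (identityʳ _) s∼a

      kernelˡ : ∀ {a x s} → x ⊕ a ≡ just s → s ∼ a → x ∼ 𝟎
      kernelˡ x⊕a s∼a = proj₂ c4 ∼-refl x⊕a (identityˡ _) s∼a

      kernel-to-right : ∀ {i d a} → i ⊕ d ≡ just a → i ∼ 𝟎 →
                        Σ Carrier λ k → (d ⊕ k ≡ just a) × k ∼ 𝟎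
      kernel-to-right i⊕d i∼0 with proj₂ (comm-ish i⊕d)
      ... | k , d⊕k = k , d⊕k , kernelʳ d⊕k (absorbˡ i⊕d i∼0)

      difference-in-kernel : ∀ {e a} → e ≤ a → a ∼ e →
                             Σ Carrier λ x → (x ⊕ e ≡ just a) × x ∼ 𝟎
      difference-in-kernel e≤a a∼e with ≤⇒right-summand e≤a
      ... | x , x⊕e = x , x⊕e , kernelˡ x⊕e a∼e

      -- Directed classes yield (CR): use common lower and upper bounds within the class.
      directed⇒CR : AllClassesDirected _∼_ → CR _∼_
      directed⇒CR dir {a} {b} a∼b
        with proj₁ (dir a) ∼-refl (∼-sym a∼b) | proj₂ (dir a) ∼-refl (∼-sym a∼b)
      ... | z , z∼a , z≤a , z≤b | w , w∼a , a≤w , b≤w =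
        z , w ,
        difference-in-kernel z≤a (∼-sym z∼a) ,
        difference-in-kernel z≤b (∼-trans (∼-sym a∼b) (∼-sym z∼a)) ,
        difference-in-kernel a≤w w∼a ,
        difference-in-kernel b≤w (∼-trans w∼a a∼b)

      -- With (C4) the kernel is normal: a ⊕ x = x ⊕ b keeps the class of x.
      kernel-normal : IsNormal (Kernel _∼_)
      kernel-normal a⊕x x⊕b =
        mk⇔ (λ a∼0 → kernelʳ x⊕b (absorbˡ a⊕x a∼0))
            (λ b∼0 → kernelˡ a⊕x (absorbʳ x⊕b b∼0))

      kernel-R2ii : CR _∼_ → R2ii (Kernel _∼_)
      kernel-R2ii cr i∼0 i⊕e b⊕e with proj₂ (extendable b⊕e) (absorbˡ i⊕e i∼0)
      ... | b₂ , b₂∼b , b₂⊕a with cr (∼-sym b₂∼b)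
      ... | e , _ , (x , x⊕e , x∼0) , (_ , x'⊕e , _) , _ with kernel-to-right x⊕e x∼0
      ... | k , e⊕k , k∼0 = k , k∼0 , e , e⊕k , defined-summandˡ b₂⊕a x'⊕e

      ∼⇒∼I : CR _∼_ → ∀ {a b} → a ∼ b → _∼I_ (Kernel _∼_) a b
      ∼⇒∼I cr a∼b with cr a∼b
      ... | e , _ , (x , x⊕e , x∼0) , (y , y⊕e , y∼0) , _
        with kernel-to-right x⊕e x∼0 | kernel-to-right y⊕e y∼0
      ... | i , e⊕i , i∼0 | j , e⊕j , j∼0 = i , j , i∼0 , j∼0 , e , e⊕i , e⊕j

      -- Write s = a ⊕ b = (ê ⊕ i) ⊕ e₂ with ê ∼ a, e₂ ∼ b,
      -- then a = y ⊕ j, ê = y ⊕ n and b = k ⊕ z, e₂ = p ⊕ z with j, n, k, p ∈ I.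
      -- Cancelling y and z in y ⊕ (j ⊕ k) ⊕ z = y ⊕ (n ⊕ i ⊕ p) ⊕ z gives
      -- j ⊕ k = (n ⊕ i) ⊕ p, which lies above i.
      kernel-R1 : C5′ _∼_ → CR _∼_ → R1 (Kernel _∼_)
      kernel-R1 split cr {i} i∼0 a⊕b (_ , i⊕e)
        with kernel-summand-to-middle split i∼0 i⊕e a⊕b
      ... | ê , e₂ , f , ê⊕i , f⊕e₂ , ê∼a , e₂∼b
        with ∼⇒∼I cr (∼-sym ê∼a) | cr (∼-sym e₂∼b)
      ... | j , n , j∼0 , _ , y , y⊕j , y⊕n | z , _ , (k , k⊕z , k∼0) , (p , p⊕z , _) , _
        with interchange y⊕j k⊕z a⊕b | assocˡ y⊕n ê⊕i
      ... | t , g , j⊕k , t⊕z , y⊕g | h , n⊕i , y⊕h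
        with interchange y⊕h p⊕z f⊕e₂
      ... | t' , g' , h⊕p , t'⊕z , y⊕g' =
        j , k , j∼0 , k∼0 , right-summand⇒≤ y⊕j , (z , k⊕z) , t , j⊕k , i≤t
        where
        i≤t : i ≤ t
        i≤t = subst (i ≤_) (cancel-outer t'⊕z y⊕g' t⊕z y⊕g)
                    (≤-trans (right-summand⇒≤ n⊕i) (p , h⊕p))

theorem4p11 : ∀ {c r : Level} (P : GPEA c) → let open GPEATheory P in
    (∀ (_∼_ : Carrier → Carrier → Set r) →
    IsCongruence _∼_ → C4 _∼_ → C5′ _∼_ →
    (IsRieszCongruence _∼_ ⇔ AllClassesDirected _∼_))
    × (∀ (_∼_ : Carrier → Carrier → Set r) →
    IsRieszCongruence _∼_ →
    IsNormal (Kernel _∼_) × IsRieszIdeal (Kernel _∼_)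
    × (∀ a b → (a ∼ b ⇔ _∼I_ (Kernel _∼_) a b)))
theorem4p11 P = part-i , part-ii
  where
  open GPEATheory P

  part-i : ∀ _∼_ → IsCongruence _∼_ → C4 _∼_ → C5′ _∼_ →
           (IsRieszCongruence _∼_ ⇔ AllClassesDirected _∼_)
  -- The implicit arguments of (C5′) and (CR) are abstracted explicitly, so that
  -- they are not instantiated when the components are paired.
  part-i _ cong c4 split =
    mk⇔ (λ (_ , _ , _ , cr) → CR⇒directed P cong cr)
        (λ dir → cong , c4 , (λ {a b x s} → split {a} {b} {x} {s}) ,
                 (λ {a b} → directed⇒CR P cong c4 dir {a} {b}))

  part-ii : ∀ _∼_ → IsRieszCongruence _∼_ →
            IsNormal (Kernel _∼_) × IsRieszIdeal (Kernel _∼_)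
            × (∀ a b → (a ∼ b ⇔ _∼I_ (Kernel _∼_) a b))
  part-ii _ (cong , c4 , split , cr) =
    kernel-normal P cong c4 ,
    (kernel-ideal P cong split , kernel-R1 P cong c4 split cr ,
     kernel-R2i P cong cr , kernel-R2ii P cong c4 cr) ,
    λ _ _ → mk⇔ (∼⇒∼I P cong c4 cr) (∼I⇒∼ P cong)
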